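{- In the setting where $D$ is an $n\times n$ nonnegative integer demand matrix, ALG is the greedy algorithm that at each time step $t=0,1,\dots$ transmits an arbitrary maximal fractional matching of the residual demand matrix $D(t)$ and finishes at time $T$, and the dual values are $\alpha^S_{ij}=D^S_i(0)$, $\beta^S_{it}=\tfrac14 D^S_i(t)$, $\alpha^R_{ij}=D^R_j(0)$, $\beta^R_{jt}=\tfrac14 D^R_j(t)$ (for $i,j\in N$, $0\le t\le T$), the solution $(\alpha^S,\beta^S)$ is feasible for the linear program \[ (\mathrm{DS})\quad \max \sum_{i,j} D_{ij}\alpha^S_{ij}-\sum_i\sum_{t=0}^T\beta^S_{it}\ \text{ s.t. } \alpha^S_{ij}-t\le 4\beta^S_{it}\ \ \forall i,j\in N,\,0\le t\le T,\quad \alpha^S,\beta^S\ge0, \] and the solution $(\alpha^R,\beta^R)$ is feasible for the linear program \[ (\mathrm{DR})\quad \max \sum_{i,j} D_{ij}\alpha^R_{ij}-\sum_j\sum_{t=0}^T\beta^R_{jt}\ \text{ s.t. } \alpha^R_{ij}-t\le 4\beta^R_{jt}\ \ \forall i,j\in N,\,0\le t\le T,\quad \alpha^R,\beta^R\ge0. \]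
   Context: Nodes $N=\{0,\dots,n-1\}$. A fractional matching in step $t$ is a nonnegative matrix $x$ (amount $x_{ij}$ sent from $i$ to $j$ during $[t,t+1]$) with all row and column sums at most $1$. $D_{ij}(t)$ is the amount of data from $i$ to $j$ not yet transmitted by ALG at time $t$; $D^S_i(t)=\sum_j D_{ij}(t)$ and $D^R_j(t)=\sum_i D_{ij}(t)$. A fractional matching $x$ of $D(t)$ satisfies $x_{ij}\le D_{ij}(t)$, and it is maximal if no entry can be increased while keeping $x_{ij}\le D_{ij}(t)$ and all row and column sums at most $1$.
   Formalization: The fractional matchings transmitted by ALG at each time step have rational entries. -}

module Defs where

open import Data.Nat as ℕ using (ℕ; zero; suc)
open import Data.Fin using (Fin; _≟_)
open import Data.Integer using (+_)
open import Data.Rational using (ℚ; 0ℚ; 1ℚ; _+_; _-_; _*_; _≤_; _<_; _/_)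
open import Data.Product using (_×_; ∃; ∃₂)
open import Data.Bool using (if_then_else_)
open import Relation.Nullary using (¬_; does)
open import Relation.Binary.PropositionalEquality using (_≡_)

ℕ→ℚ : ℕ → ℚ
ℕ→ℚ k = + k / 1

Σ[_] : (n : ℕ) → (Fin n → ℚ) → ℚ
Σ[ zero ] f = 0ℚ
Σ[ suc n ] f = f Fin.zero + Σ[ n ] (λ i → f (Fin.suc i))
  where import Data.Fin as Fin

Matrix : ℕ → Set
Matrix n = Fin n → Fin n → ℚ

rowSum : ∀ {n} → Matrix n → Fin n → ℚ
rowSum {n} x i = Σ[ n ] (λ j → x i j)

colSum : ∀ {n} → Matrix n → Fin n → ℚ
colSum {n} x j = Σ[ n ] (λ i → x i j)

IsFracMatchingOf : ∀ {n} → Matrix n → Matrix n → Set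
IsFracMatchingOf {n} R x =
  (∀ i j → 0ℚ ≤ x i j) × (∀ i j → x i j ≤ R i j) ×
  (∀ i → rowSum x i ≤ 1ℚ) × (∀ j → colSum x j ≤ 1ℚ)

bump : ∀ {n} → Matrix n → Fin n → Fin n → ℚ → Matrix n
bump x i j ε k l = if does (k ≟ i) then (if does (l ≟ j) then x k l + ε else x k l) else x k l

IsMaximalFracMatchingOf : ∀ {n} → Matrix n → Matrix n → Set
IsMaximalFracMatchingOf {n} R x =
  IsFracMatchingOf R x ×
  (∀ i j (ε : ℚ) → 0ℚ < ε → ¬ IsFracMatchingOf R (bump x i j ε))

Residual : ∀ {n} → (Fin n → Fin n → ℕ) → (ℕ → Matrix n) → ℕ → Matrix n
Residual D x zero i j = ℕ→ℚ (D i j)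
Residual D x (suc t) i j = Residual D x t i j - x t i j

IsGreedyRun : ∀ {n} → (Fin n → Fin n → ℕ) → (ℕ → Matrix n) → ℕ → Set
IsGreedyRun {n} D x T =
  (∀ t → t ℕ.< T → IsMaximalFracMatchingOf (Residual D x t) (x t)) ×
  (∀ i j → Residual D x T i j ≡ 0ℚ) ×
  (∀ t → t ℕ.< T → ∃₂ λ i j → ¬ (Residual D x t i j ≡ 0ℚ))

DSrun : ∀ {n} → (Fin n → Fin n → ℕ) → (ℕ → Matrix n) → Fin n → ℕ → ℚ
DSrun {n} D x i t = Σ[ n ] (λ j → Residual D x t i j)

DRrun : ∀ {n} → (Fin n → Fin n → ℕ) → (ℕ → Matrix n) → Fin n → ℕ → ℚ
DRrun {n} D x j t = Σ[ n ] (λ i → Residual D x t i j)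

FeasibleDS : (n T : ℕ) → (Fin n → Fin n → ℚ) → (Fin n → ℕ → ℚ) → Set
FeasibleDS n T α β =
  (∀ i j t → t ℕ.≤ T → α i j - ℕ→ℚ t ≤ ℕ→ℚ 4 * β i t) ×
  (∀ i j → 0ℚ ≤ α i j) × (∀ i t → t ℕ.≤ T → 0ℚ ≤ β i t)

FeasibleDR : (n T : ℕ) → (Fin n → Fin n → ℚ) → (Fin n → ℕ → ℚ) → Set
FeasibleDR n T α β =
  (∀ i j t → t ℕ.≤ T → α i j - ℕ→ℚ t ≤ ℕ→ℚ 4 * β j t) ×
  (∀ i j → 0ℚ ≤ α i j) × (∀ j t → t ℕ.≤ T → 0ℚ ≤ β j t)

¼ : ℚ
¼ = + 1 / 4

-- Each step transmits a fractional matching, so every sender's (receiver's)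
-- residual demand drops by at most its row (column) sum, hence by at most 1
-- per step; after t steps it is therefore at least its initial value minus t,
-- which is the dual constraint, and nonnegativity holds because transmissions
-- never exceed the residual demand.
module Submission where

open import Defs
open import Data.Nat as ℕ using (ℕ; zero; suc)
import Data.Nat.Properties as ℕ
open import Data.Nat.Coprimality using (1-coprimeTo) renaming (sym to coprime-sym)
open import Data.Fin as Fin using (Fin)
open import Data.Integer as ℤ using (ℤ; +_)
open import Data.Integer.Tactic.RingSolver using (solve-∀)
open import Data.Rational using (ℚ; mkℚ; toℚᵘ; 0ℚ; 1ℚ; _+_; _-_; -_; _*_; _≤_)
open import Data.Rational.Properties
open import Data.Rational.Solver using (module +-*-Solver)
import Data.Rational.Unnormalised as ℚᵘ
import Data.Rational.Unnormalised.Properties as ℚᵘ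
open import Data.Vec.Functional using (tail)
open import Function using (_∘_)
open import Data.Product using (_×_; _,_; proj₁; proj₂)
open import Relation.Binary.PropositionalEquality

-- ℕ→ℚ k computes a gcd; this is the same number with its normal form given directly.
ℕ→ℚ′ : ℕ → ℚ
ℕ→ℚ′ k = mkℚ (+ k) 0 (coprime-sym (1-coprimeTo k))

ℕ→ℚ≡ℕ→ℚ′ : ∀ k → ℕ→ℚ k ≡ ℕ→ℚ′ k
ℕ→ℚ≡ℕ→ℚ′ k = normalize-coprime (coprime-sym (1-coprimeTo k))

ℕ→ℚ-suc : ∀ k → ℕ→ℚ (suc k) ≡ ℕ→ℚ k + 1ℚ
ℕ→ℚ-suc k = begin
  ℕ→ℚ (suc k)          ≡⟨ ℕ→ℚ≡ℕ→ℚ′ (suc k) ⟩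
  ℕ→ℚ′ (suc k)         ≡⟨ toℚᵘ-injective unnormalised ⟩
  ℕ→ℚ′ k + ℕ→ℚ′ 1      ≡⟨ cong₂ _+_ (sym (ℕ→ℚ≡ℕ→ℚ′ k)) (sym (ℕ→ℚ≡ℕ→ℚ′ 1)) ⟩
  ℕ→ℚ k + 1ℚ           ∎
  where
  open ≡-Reasoning
  cross-multiplied : ∀ (z : ℤ) → (+ 1 ℤ.+ z) ℤ.* (+ 1 ℤ.* + 1) ≡ (z ℤ.* + 1 ℤ.+ + 1 ℤ.* + 1) ℤ.* + 1
  cross-multiplied = solve-∀
  unnormalised : toℚᵘ (ℕ→ℚ′ (suc k)) ℚᵘ.≃ toℚᵘ (ℕ→ℚ′ k + ℕ→ℚ′ 1)
  unnormalised = ℚᵘ.≃-sym (ℚᵘ.≃-trans (toℚᵘ-homo-+ (ℕ→ℚ′ k) (ℕ→ℚ′ 1)) (ℚᵘ.*≡* (sym (cross-multiplied (+ k)))))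

ℕ→ℚ-nonNeg : ∀ k → 0ℚ ≤ ℕ→ℚ k
ℕ→ℚ-nonNeg k = nonNegative⁻¹ (ℕ→ℚ k) {{normalize-nonNeg k 1}}

4*[¼*p]≡p : ∀ p → ℕ→ℚ 4 * (¼ * p) ≡ p
4*[¼*p]≡p p = trans (sym (*-assoc (ℕ→ℚ 4) ¼ p)) (*-identityˡ p)

≤⇒≤4*¼* : ∀ {p q} → p ≤ q → p ≤ ℕ→ℚ 4 * (¼ * q)
≤⇒≤4*¼* {q = q} p≤q = ≤-trans p≤q (≤-reflexive (sym (4*[¼*p]≡p q)))

¼*-nonNeg : ∀ {p} → 0ℚ ≤ p → 0ℚ ≤ ¼ * p
¼*-nonNeg = *-monoˡ-≤-nonNeg ¼ {{normalize-nonNeg 1 4}}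

p≤q⇒0≤q-p : ∀ {p q} → p ≤ q → 0ℚ ≤ q - p
p≤q⇒0≤q-p {p} p≤q = ≤-trans (≤-reflexive (sym (+-inverseʳ p))) (+-monoˡ-≤ (- p) p≤q)

Σ-distrib-sub : ∀ n (f g : Fin n → ℚ) → Σ[ n ] (λ i → f i - g i) ≡ Σ[ n ] f - Σ[ n ] g
Σ-distrib-sub zero    f g = refl
Σ-distrib-sub (suc n) f g = begin
  (f₀ - g₀) + Σ[ n ] (λ i → tail f i - tail g i)   ≡⟨ cong (λ s → (f₀ - g₀) + s) (Σ-distrib-sub n (tail f) (tail g)) ⟩
  (f₀ - g₀) + (Σ[ n ] (tail f) - Σ[ n ] (tail g))  ≡⟨ interchange f₀ g₀ _ _ ⟩
  (f₀ + Σ[ n ] (tail f)) - (g₀ + Σ[ n ] (tail g))  ∎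
  where
  open ≡-Reasoning
  open +-*-Solver
  f₀ = f Fin.zero
  g₀ = g Fin.zero
  interchange : ∀ a b c d → (a - b) + (c - d) ≡ (a + c) - (b + d)
  interchange = solve 4 (λ a b c d → (a :- b) :+ (c :- d) := (a :+ c) :- (b :+ d)) refl

Σ-nonNeg : ∀ n {f : Fin n → ℚ} → (∀ i → 0ℚ ≤ f i) → 0ℚ ≤ Σ[ n ] f
Σ-nonNeg zero    _  = ≤-refl
Σ-nonNeg (suc n) f≥0 = +-mono-≤ (f≥0 Fin.zero) (Σ-nonNeg n (f≥0 ∘ Fin.suc))

≥start-minus-steps : ∀ (a : ℕ → ℚ) T → (∀ t → t ℕ.< T → a t - 1ℚ ≤ a (suc t)) →
                     ∀ t → t ℕ.≤ T → a 0 - ℕ→ℚ t ≤ a t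
≥start-minus-steps a T step zero    _    = ≤-reflexive (+-identityʳ (a 0))
≥start-minus-steps a T step (suc t) t<T = begin
  a 0 - ℕ→ℚ (suc t)      ≡⟨ cong (λ s → a 0 - s) (ℕ→ℚ-suc t) ⟩
  a 0 - (ℕ→ℚ t + 1ℚ)     ≡⟨ regroup (a 0) (ℕ→ℚ t) ⟩
  (a 0 - ℕ→ℚ t) - 1ℚ     ≤⟨ +-monoˡ-≤ (- 1ℚ) (≥start-minus-steps a T step t (ℕ.<⇒≤ t<T)) ⟩
  a t - 1ℚ               ≤⟨ step t t<T ⟩
  a (suc t)              ∎
  where
  open ≤-Reasoning
  open +-*-Solver
  regroup : ∀ p q → p - (q + 1ℚ) ≡ (p - q) - 1ℚ
  regroup = solve 2 (λ p q → p :- (q :+ con 1ℚ) := (p :- q) :- con 1ℚ) refl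

module _ {n} (D : Fin n → Fin n → ℕ) (x : ℕ → Matrix n) {T : ℕ}
         (matching : ∀ t → t ℕ.< T → IsFracMatchingOf (Residual D x t) (x t)) where

  Residual-nonNeg : ∀ t → t ℕ.≤ T → ∀ i j → 0ℚ ≤ Residual D x t i j
  Residual-nonNeg zero    _   i j = ℕ→ℚ-nonNeg (D i j)
  Residual-nonNeg (suc t) t<T i j = p≤q⇒0≤q-p (proj₁ (proj₂ (matching t t<T)) i j)

  DSrun-nonNeg : ∀ i t → t ℕ.≤ T → 0ℚ ≤ DSrun D x i t
  DSrun-nonNeg i t t≤T = Σ-nonNeg n (Residual-nonNeg t t≤T i)

  DRrun-nonNeg : ∀ j t → t ℕ.≤ T → 0ℚ ≤ DRrun D x j t
  DRrun-nonNeg j t t≤T = Σ-nonNeg n (λ i → Residual-nonNeg t t≤T i j)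

  DSrun-step : ∀ i t → t ℕ.< T → DSrun D x i t - 1ℚ ≤ DSrun D x i (suc t)
  DSrun-step i t t<T = ≤-trans
    (+-monoʳ-≤ (DSrun D x i t) (neg-antimono-≤ (proj₁ (proj₂ (proj₂ (matching t t<T))) i)))
    (≤-reflexive (sym (Σ-distrib-sub n (Residual D x t i) (x t i))))

  DRrun-step : ∀ j t → t ℕ.< T → DRrun D x j t - 1ℚ ≤ DRrun D x j (suc t)
  DRrun-step j t t<T = ≤-trans
    (+-monoʳ-≤ (DRrun D x j t) (neg-antimono-≤ (proj₂ (proj₂ (proj₂ (matching t t<T))) j)))
    (≤-reflexive (sym (Σ-distrib-sub n (λ i → Residual D x t i j) (λ i → x t i j))))

lemma2 : (n : ℕ) (D : Fin n → Fin n → ℕ) (x : ℕ → Matrix n) (T : ℕ) →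
    IsGreedyRun D x T →
    FeasibleDS n T (λ i j → DSrun D x i 0) (λ i t → ¼ * DSrun D x i t) ×
    FeasibleDR n T (λ i j → DRrun D x j 0) (λ j t → ¼ * DRrun D x j t)
lemma2 n D x T (maximal , _) =
  ( (λ i _ t t≤T → ≤⇒≤4*¼* (≥start-minus-steps (DSrun D x i) T (DSrun-step D x matching i) t t≤T))
  , (λ i _ → DSrun-nonNeg D x matching i 0 ℕ.z≤n)
  , (λ i t t≤T → ¼*-nonNeg (DSrun-nonNeg D x matching i t t≤T)) )
  ,
  ( (λ _ j t t≤T → ≤⇒≤4*¼* (≥start-minus-steps (DRrun D x j) T (DRrun-step D x matching j) t t≤T))
  , (λ _ j → DRrun-nonNeg D x matching j 0 ℕ.z≤n)
  , (λ j t t≤T → ¼*-nonNeg (DRrun-nonNeg D x matching j t t≤T)) )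
  where
  matching : ∀ t → t ℕ.< T → IsFracMatchingOf (Residual D x t) (x t)
  matching t t<T = proj₁ (maximal t t<T)
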